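{- There is a constant $C$ such that for every positive integer $n$, the property STCON$(n)$ can be expressed by a first-order sentence with at most $3\log_3(n)+C$ quantifiers.
   Context: Graphs (directed or undirected) are structures with a binary edge relation $E$ and two constant symbols $s,t$ naming distinguished vertices. STCON$(n)$ is the property that there is a path from $s$ to $t$ consisting of at most $n$ edges. The number of quantifiers of a sentence is the number of occurrences of $\forall$ and $\exists$ in it. -}

module Defs where

open import Data.Nat using (ℕ; zero; suc; _+_; _≤_)
open import Data.Fin using (Fin)
open import Data.Bool using (Bool; true)
open import Data.Product using (Σ; ∃; _×_)
open import Data.Sum using (_⊎_)
open import Data.Empty using (⊥)
open import Relation.Binary.PropositionalEquality using (_≡_)
open import Relation.Nullary using (¬_)

record Graph (m : ℕ) : Set where
  field
    E : Fin m → Fin m → Bool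
    s : Fin m
    t : Fin m
open Graph public

-- First-order logic over the vocabulary {E, s, t} (with equality).
-- Formula k : formulas with free variables among k de Bruijn-indexed variables.
data Term (k : ℕ) : Set where
  var : Fin k → Term k
  cs  : Term k
  ct  : Term k

data Formula (k : ℕ) : Set where
  edge : Term k → Term k → Formula k
  eq   : Term k → Term k → Formula k
  neg  : Formula k → Formula k
  and  : Formula k → Formula k → Formula k
  or   : Formula k → Formula k → Formula k
  all  : Formula (suc k) → Formula k
  ex   : Formula (suc k) → Formula k

Sentence : Set
Sentence = Formula 0

qcount : ∀ {k} → Formula k → ℕ
qcount (edge _ _) = 0
qcount (eq _ _)   = 0
qcount (neg φ)    = qcount φ
qcount (and φ ψ)  = qcount φ + qcount ψ
qcount (or φ ψ)   = qcount φ + qcount ψ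
qcount (all φ)    = suc (qcount φ)
qcount (ex φ)     = suc (qcount φ)

extend : ∀ {m k} → (Fin k → Fin m) → Fin m → Fin (suc k) → Fin m
extend ρ a Fin.zero    = a
extend ρ a (Fin.suc i) = ρ i

evalTerm : ∀ {m k} → Graph m → (Fin k → Fin m) → Term k → Fin m
evalTerm G ρ (var i) = ρ i
evalTerm G ρ cs      = s G
evalTerm G ρ ct      = t G

Sat : ∀ {m k} → Graph m → (Fin k → Fin m) → Formula k → Set
Sat G ρ (edge a b) = E G (evalTerm G ρ a) (evalTerm G ρ b) ≡ true
Sat G ρ (eq a b)   = evalTerm G ρ a ≡ evalTerm G ρ b
Sat G ρ (neg φ)    = ¬ Sat G ρ φ
Sat G ρ (and φ ψ)  = Sat G ρ φ × Sat G ρ ψ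
Sat G ρ (or φ ψ)   = Sat G ρ φ ⊎ Sat G ρ ψ
Sat G ρ (all φ)    = (a : Fin _) → Sat G (extend ρ a) φ
Sat G ρ (ex φ)     = Σ (Fin _) (λ a → Sat G (extend ρ a) φ)

noVars : ∀ {m} → Fin 0 → Fin m
noVars ()

Models : ∀ {m} → Graph m → Sentence → Set
Models G φ = Sat G noVars φ

data Walk {m : ℕ} (G : Graph m) : Fin m → Fin m → ℕ → Set where
  here : ∀ {x} → Walk G x x 0
  step : ∀ {x y z k} → E G x y ≡ true → Walk G y z k → Walk G x z (suc k)

STCON : ℕ → ∀ {m} → Graph m → Set
STCON n G = ∃ λ k → k ≤ n × Walk G (s G) (t G) k

-- Write n with digits (e₁ , e₂) of value 3q + e₁ + e₂. A walk of length at most 3q + e₁ + e₂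
-- from x splits at two checkpoints a, b into legs x ⇝ a, a ⇝ b, b ⇝ goal of lengths at most
-- q + e₁, q + e₂ and q. The sentence guesses a and b with two ∃; then one ∀ over u ∈ {x, a, b}
-- checks the leg starting at u with a single copy of the formula for q, whose target is selected
-- by comparing u with b and a, the extra e-edge being absorbed into the target. So each digit
-- costs three quantifiers, and the ternary expansion of n gives 3 log₃ n + O(1) of them.
module Submission where

open import Defs
open import Data.Nat using (ℕ; _≤_; _^_; _∸_)
open import Data.Product using (Σ; _×_)
open import Function.Bundles using (_⇔_)

open import Data.Bool using (Bool; true; false)
open import Data.Empty using (⊥-elim)
open import Data.Fin using (Fin; zero; suc; _≟_)
open import Data.List using (List; []; _∷_; length)
open import Data.Nat using (zero; suc; _+_; _*_; _<_; z≤n; s≤s)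
open import Data.Nat.Induction using (<-rec)
open import Data.Nat.Properties
  using (≤-refl; ≤-reflexive; ≤-trans; <-≤-trans; m<m+n; m≤m+n; m≤n+m; +-mono-≤; *-monoʳ-≤; *-cancelˡ-≤; ^-monoˡ-≤; ^-*-assoc; +-identityʳ)
open import Data.Nat.Tactic.RingSolver using (solve-∀)
open import Data.Product using (∃; ∃₂; _,_)
open import Data.Product.Function.NonDependent.Propositional using (_×-⇔_)
open import Data.Sum using (_⊎_; inj₁; inj₂)
open import Data.Sum.Function.Propositional using (_⊎-⇔_)
open import Function.Bundles using (Equivalence; mk⇔)
open import Function.Construct.Composition using (_⇔-∘_)
open import Function.Construct.Identity using (⇔-id)
open import Function.Construct.Symmetry using (⇔-sym)
open import Function.Related.TypeIsomorphisms using (¬-cong-⇔)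
open import Relation.Binary.PropositionalEquality using (_≡_; _≢_; refl; sym; trans; cong; cong₂; subst; subst₂)
open import Relation.Nullary using (¬_; Dec; yes; no)
open import Relation.Nullary.Decidable using (_⊎-dec_)

open Equivalence using (to; from)

∀-cong-⇔ : {X : Set} {A B : X → Set} → (∀ x → A x ⇔ B x) → ((x : X) → A x) ⇔ ((x : X) → B x)
∀-cong-⇔ A⇔B = mk⇔ (λ f x → to (A⇔B x) (f x)) (λ g x → from (A⇔B x) (g x))

¬⊎⇔→ : {A B : Set} → Dec A → (¬ A ⊎ B) ⇔ (A → B)
¬⊎⇔→ A? = mk⇔ (λ { (inj₁ ¬a) a → ⊥-elim (¬a a) ; (inj₂ b) _ → b }) (implication A?)
  where
  implication : ∀ {A B : Set} → Dec A → (A → B) → ¬ A ⊎ B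
  implication (yes a) f = inj₂ (f a)
  implication (no ¬a) _ = inj₁ ¬a

∃-cong-⇔ : {X : Set} {A B : X → Set} → (∀ x → A x ⇔ B x) → Σ X A ⇔ Σ X B
∃-cong-⇔ A⇔B = mk⇔ (λ (x , a) → x , to (A⇔B x) a) (λ (x , b) → x , from (A⇔B x) b)

b2n : Bool → ℕ
b2n false = 0
b2n true  = 1

Digit : Set
Digit = Bool × Bool

valD : Digit → ℕ → ℕ
valD (e₁ , e₂) q = (q + b2n e₁) + ((q + b2n e₂) + q)

val : List Digit → ℕ
val []       = 0
val (d ∷ ds) = valD d (val ds)

valD-suc : ∀ d q → valD d (suc q) ≡ 3 + valD d q
valD-suc (e₁ , e₂) q = shift q (b2n e₁) (b2n e₂)
  where
  shift : ∀ q a b → (suc q + a) + ((suc q + b) + suc q) ≡ 3 + ((q + a) + ((q + b) + q))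
  shift = solve-∀

3q≤valD : ∀ d q → 3 * q ≤ valD d q
3q≤valD (e₁ , e₂) q = +-mono-≤ (m≤m+n q (b2n e₁)) (+-mono-≤ (m≤m+n q (b2n e₂)) (≤-reflexive (+-identityʳ q)))

divMod3 : ∀ n → Σ Digit λ d → Σ ℕ λ q → valD d q ≡ n
divMod3 0 = (false , false) , 0 , refl
divMod3 1 = (true , false) , 0 , refl
divMod3 2 = (true , true) , 0 , refl
divMod3 (suc (suc (suc n))) with divMod3 n
... | d , q , valD≡n = d , suc q , subst (λ k → valD d (suc q) ≡ 3 + k) valD≡n (valD-suc d q)

ternary : ∀ n → 1 ≤ n → Σ (List Digit) λ ds → val ds ≡ n × 3 ^ length ds ≤ 3 * n
ternary = <-rec _ expand
  where
  expand : ∀ n → (∀ {q} → q < n → 1 ≤ q → Σ (List Digit) λ ds → val ds ≡ q × 3 ^ length ds ≤ 3 * q) →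
           1 ≤ n → Σ (List Digit) λ ds → val ds ≡ n × 3 ^ length ds ≤ 3 * n
  expand n rec 1≤n with divMod3 n
  ... | d , zero , refl = d ∷ [] , refl , *-monoʳ-≤ 3 1≤n
  ... | d , suc q , refl with rec (<-≤-trans (m<m+n (suc q) (s≤s z≤n)) (3q≤valD d (suc q))) (s≤s z≤n)
  ...   | ds , val≡q , bound = d ∷ ds , cong (valD d) val≡q , *-monoʳ-≤ 3 (≤-trans bound (3q≤valD d (suc q)))

cube-bound : ∀ L n → 1 ≤ n → 3 ^ L ≤ 3 * n → 3 ^ (L * 3 ∸ 3) ≤ n ^ 3
cube-bound zero    n 1≤n _     = ^-monoˡ-≤ 3 1≤n
cube-bound (suc L) n _   3ᴸ≤3n = subst (_≤ n ^ 3) (^-*-assoc 3 L 3) (^-monoˡ-≤ 3 (*-cancelˡ-≤ {3 ^ L} {n} 3 3ᴸ≤3n))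

module Reachability {m : ℕ} (G : Graph m) where

  data Reach (n : ℕ) (x : Fin m) (P : Fin m → Set) : Set where
    reach : ∀ {w j} → j ≤ n → Walk G x w j → P w → Reach n x P

  _++ʷ_ : ∀ {x y z i j} → Walk G x y i → Walk G y z j → Walk G x z (i + j)
  here      ++ʷ W′ = W′
  step e W  ++ʷ W′ = step e (W ++ʷ W′)

  Reach-map : ∀ {n x} {P Q : Fin m → Set} → (∀ {w} → P w → Q w) → Reach n x P → Reach n x Q
  Reach-map f (reach j≤n W p) = reach j≤n W (f p)

  Reach-mono : ∀ {n n′ x} {P : Fin m → Set} → n ≤ n′ → Reach n x P → Reach n′ x P
  Reach-mono n≤n′ (reach j≤n W p) = reach (≤-trans j≤n n≤n′) W p

  Reach-cong : ∀ {n x} {P Q : Fin m → Set} → (∀ w → P w ⇔ Q w) → Reach n x P ⇔ Reach n x Q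
  Reach-cong P⇔Q = mk⇔ (Reach-map (to (P⇔Q _))) (Reach-map (from (P⇔Q _)))

  Reach-≡⇔Walk : ∀ {n x y} → Reach n x (_≡ y) ⇔ ∃ λ j → j ≤ n × Walk G x y j
  Reach-≡⇔Walk = mk⇔ (λ { (reach j≤n W refl) → _ , j≤n , W }) (λ (_ , j≤n , W) → reach j≤n W refl)

  Reach-zero : ∀ {x} {P : Fin m → Set} → Reach 0 x P ⇔ P x
  Reach-zero = mk⇔ (λ { (reach _ here p) → p ; (reach () (step _ _) _) }) (reach z≤n here)

  Reach-one : ∀ {x y} → Reach 1 x (_≡ y) ⇔ (x ≡ y ⊎ E G x y ≡ true)
  Reach-one = mk⇔ one⇒ one⇐
    where
    one⇒ : ∀ {x y} → Reach 1 x (_≡ y) → x ≡ y ⊎ E G x y ≡ true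
    one⇒ (reach _ here refl)            = inj₁ refl
    one⇒ (reach _ (step e here) refl)   = inj₂ e
    one⇒ (reach (s≤s ()) (step _ (step _ _)) _)
    one⇐ : ∀ {x y} → x ≡ y ⊎ E G x y ≡ true → Reach 1 x (_≡ y)
    one⇐ (inj₁ refl) = reach z≤n here refl
    one⇐ (inj₂ e)    = reach ≤-refl (step e here) refl

  Reach-join : ∀ {i j x} {P : Fin m → Set} → Reach i x (λ y → Reach j y P) → Reach (i + j) x P
  Reach-join (reach j₁≤i W (reach j₂≤j W′ p)) = reach (+-mono-≤ j₁≤i j₂≤j) (W ++ʷ W′) p

  Reach-split : ∀ i {j x} {P : Fin m → Set} → Reach (i + j) x P → Reach i x (λ y → Reach j y P)
  Reach-split zero    R                                = reach z≤n here R
  Reach-split (suc i) (reach _ here p)                 = reach z≤n here (reach z≤n here p)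
  Reach-split (suc i) (reach (s≤s k≤i+j) (step e W) p) with Reach-split i (reach k≤i+j W p)
  ... | reach j₁≤i W₁ R = reach (s≤s j₁≤i) (step e W₁) R

  Reach-trans : ∀ {i j x y} {P : Fin m → Set} → Reach i x (_≡ y) → Reach j y P → Reach (i + j) x P
  Reach-trans Rxy Ry = Reach-join (Reach-map (λ { refl → Ry }) Rxy)

  Reach-witness : ∀ {n x} {P : Fin m → Set} → Reach n x P → Σ (Fin m) λ y → Reach n x (_≡ y) × P y
  Reach-witness (reach j≤n W p) = _ , reach j≤n W refl , p

  -- The checkpoints x, a, b of a path x ⇝ a ⇝ b ⇝ P may coincide, so b takes precedence over a and a over x.
  data Leg (e₁ e₂ : Bool) (a b : Fin m) (P : Fin m → Set) (u w : Fin m) : Set where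
    at-b : u ≡ b → P w → Leg e₁ e₂ a b P u w
    at-a : u ≢ b → u ≡ a → Reach (b2n e₂) w (_≡ b) → Leg e₁ e₂ a b P u w
    at-x : u ≢ b → u ≢ a → Reach (b2n e₁) w (_≡ a) → Leg e₁ e₂ a b P u w

  Legs : Bool → Bool → ℕ → Fin m → (Fin m → Set) → Fin m → Fin m → Set
  Legs e₁ e₂ q x P a b = ∀ u → u ≡ b ⊎ u ≡ a ⊎ u ≡ x → Reach q u (Leg e₁ e₂ a b P u)

  Leg-b : ∀ {e₁ e₂ a b P w} → Leg e₁ e₂ a b P b w → P w
  Leg-b (at-b _ p)       = p
  Leg-b (at-a b≢b _ _)   = ⊥-elim (b≢b refl)
  Leg-b (at-x b≢b _ _)   = ⊥-elim (b≢b refl)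

  Leg-a : ∀ {e₁ e₂ a b P w} → a ≢ b → Leg e₁ e₂ a b P a w → Reach (b2n e₂) w (_≡ b)
  Leg-a a≢b (at-b a≡b _)   = ⊥-elim (a≢b a≡b)
  Leg-a _   (at-a _ _ r)   = r
  Leg-a _   (at-x _ a≢a _) = ⊥-elim (a≢a refl)

  Leg-x : ∀ {e₁ e₂ a b P u w} → u ≢ b → u ≢ a → Leg e₁ e₂ a b P u w → Reach (b2n e₁) w (_≡ a)
  Leg-x u≢b _   (at-b u≡b _)   = ⊥-elim (u≢b u≡b)
  Leg-x _   u≢a (at-a _ u≡a _) = ⊥-elim (u≢a u≡a)
  Leg-x _   _   (at-x _ _ r)   = r

  module _ {e₁ e₂ : Bool} {q : ℕ} {x : Fin m} {P : Fin m → Set} {a b : Fin m}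
           (L : Legs e₁ e₂ q x P a b) where

    Legs⇒Reach-from-b : Reach q b P
    Legs⇒Reach-from-b = Reach-map Leg-b (L b (inj₁ refl))

    Legs⇒Reach-from-a : Reach ((q + b2n e₂) + q) a P
    Legs⇒Reach-from-a with a ≟ b
    ... | yes refl = Reach-mono (m≤n+m q (q + b2n e₂)) Legs⇒Reach-from-b
    ... | no a≢b   = Reach-trans (Reach-join (Reach-map (Leg-a a≢b) (L a (inj₂ (inj₁ refl)))))
                                 Legs⇒Reach-from-b

    Legs⇒Reach : Reach (valD (e₁ , e₂) q) x P
    Legs⇒Reach with x ≟ b | x ≟ a
    ... | yes refl | _        = Reach-mono (≤-trans (m≤n+m q (q + b2n e₂)) (m≤n+m _ (q + b2n e₁))) Legs⇒Reach-from-b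
    ... | no _     | yes refl = Reach-mono (m≤n+m _ (q + b2n e₁)) Legs⇒Reach-from-a
    ... | no x≢b   | no x≢a   = Reach-trans (Reach-join (Reach-map (Leg-x x≢b x≢a) (L x (inj₂ (inj₂ refl)))))
                                            Legs⇒Reach-from-a

  Reach⇒Legs : ∀ {e₁ e₂ q x P} → Reach (valD (e₁ , e₂) q) x P → ∃₂ (Legs e₁ e₂ q x P)
  Reach⇒Legs {e₁} {e₂} {q} {x} {P} R with Reach-witness (Reach-split (q + b2n e₁) R)
  ... | a , x⇝a , Ra with Reach-witness (Reach-split (q + b2n e₂) Ra)
  ...   | b , a⇝b , Rb = a , b , legs
    where
    legs : Legs e₁ e₂ q x P a b
    legs u onRoute with u ≟ b | u ≟ a
    ... | yes refl | _        = Reach-map (at-b refl) Rb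
    ... | no u≢b   | yes refl = Reach-map (at-a u≢b refl) (Reach-split q a⇝b)
    ... | no u≢b   | no u≢a   with onRoute
    ...   | inj₁ u≡b          = ⊥-elim (u≢b u≡b)
    ...   | inj₂ (inj₁ u≡a)   = ⊥-elim (u≢a u≡a)
    ...   | inj₂ (inj₂ refl)  = Reach-map (at-x u≢b u≢a) (Reach-split q x⇝a)

  Reach-valD⇔Legs : ∀ {e₁ e₂ q x P} → Reach (valD (e₁ , e₂) q) x P ⇔ ∃₂ (Legs e₁ e₂ q x P)
  Reach-valD⇔Legs = mk⇔ Reach⇒Legs (λ (a , b , L) → Legs⇒Reach L)

weaken : ∀ {k} → Term k → Term (suc k)
weaken (var i) = var (suc i)
weaken cs      = cs
weaken ct      = ct

lift : ∀ {k k′} → (Fin k → Term k′) → Fin (suc k) → Term (suc k′)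
lift σ zero    = var zero
lift σ (suc i) = weaken (σ i)

subTerm : ∀ {k k′} → (Fin k → Term k′) → Term k → Term k′
subTerm σ (var i) = σ i
subTerm σ cs      = cs
subTerm σ ct      = ct

sub : ∀ {k k′} → (Fin k → Term k′) → Formula k → Formula k′
sub σ (edge a b) = edge (subTerm σ a) (subTerm σ b)
sub σ (eq a b)   = eq (subTerm σ a) (subTerm σ b)
sub σ (neg φ)    = neg (sub σ φ)
sub σ (and φ ψ)  = and (sub σ φ) (sub σ ψ)
sub σ (or φ ψ)   = or (sub σ φ) (sub σ ψ)
sub σ (all φ)    = all (sub (lift σ) φ)
sub σ (ex φ)     = ex (sub (lift σ) φ)

qcount-sub : ∀ {k k′} (σ : Fin k → Term k′) φ → qcount (sub σ φ) ≡ qcount φ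
qcount-sub σ (edge a b) = refl
qcount-sub σ (eq a b)   = refl
qcount-sub σ (neg φ)    = qcount-sub σ φ
qcount-sub σ (and φ ψ)  = cong₂ _+_ (qcount-sub σ φ) (qcount-sub σ ψ)
qcount-sub σ (or φ ψ)   = cong₂ _+_ (qcount-sub σ φ) (qcount-sub σ ψ)
qcount-sub σ (all φ)    = cong suc (qcount-sub (lift σ) φ)
qcount-sub σ (ex φ)     = cong suc (qcount-sub (lift σ) φ)

instantiate : ∀ {k} → Term k → Fin (suc k) → Term k
instantiate u zero    = u
instantiate u (suc i) = var i

weaken₃ : ∀ {k} → Fin k → Term (3 + k)
weaken₃ i = var (suc (suc (suc i)))

implies : ∀ {k} → Formula k → Formula k → Formula k
implies φ ψ = or (neg φ) ψ

reaches≤ : Bool → ∀ {k} → Term (suc k) → Formula (suc k)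
reaches≤ false a = eq (var zero) a
reaches≤ true  a = or (eq (var zero) a) (edge (var zero) a)

-- Context: w, u, b, a, followed by the context of θ minus its variable w.
legFormula : Bool → Bool → ∀ {k} → Formula (suc k) → Formula (4 + k)
legFormula e₁ e₂ θ =
  or (and (eq u b) (sub (lift weaken₃) θ))
     (or (and (neg (eq u b)) (and (eq u a) (reaches≤ e₂ b)))
         (and (neg (eq u b)) (and (neg (eq u a)) (reaches≤ e₁ a))))
  where
  u b a : Term _
  u = var (suc zero)
  b = var (suc (suc zero))
  a = var (suc (suc (suc zero)))

onRoute : ∀ {k} → Term k → Formula (3 + k)
onRoute x = or (eq (var zero) (var (suc zero)))
               (or (eq (var zero) (var (suc (suc zero)))) (eq (var zero) (subTerm weaken₃ x)))

within : List Digit → ∀ {k} → Term k → Formula (suc k) → Formula k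
within []                u θ = sub (instantiate u) θ
within ((e₁ , e₂) ∷ ds) u θ =
  ex (ex (all (implies (onRoute u) (within ds (var zero) (legFormula e₁ e₂ θ)))))

qcount-reaches≤ : ∀ e {k} (a : Term (suc k)) → qcount (reaches≤ e a) ≡ 0
qcount-reaches≤ false a = refl
qcount-reaches≤ true  a = refl

qcount-legFormula : ∀ e₁ e₂ {k} (θ : Formula (suc k)) → qcount (legFormula e₁ e₂ θ) ≡ qcount θ
qcount-legFormula e₁ e₂ θ =
  trans (cong₂ _+_ (qcount-sub (lift weaken₃) θ) (cong₂ _+_ (qcount-reaches≤ e₂ _) (qcount-reaches≤ e₁ _)))
        (+-identityʳ (qcount θ))

qcount-within : ∀ ds {k} (u : Term k) θ → qcount (within ds u θ) ≡ length ds * 3 + qcount θ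
qcount-within []                u θ = qcount-sub (instantiate u) θ
qcount-within ((e₁ , e₂) ∷ ds) u θ =
  cong (3 +_) (trans (qcount-within ds (var zero) (legFormula e₁ e₂ θ))
                     (cong (length ds * 3 +_) (qcount-legFormula e₁ e₂ θ)))

stcon : List Digit → Sentence
stcon ds = within ds cs (eq (var zero) ct)

qcount-stcon : ∀ ds → qcount (stcon ds) ≡ length ds * 3
qcount-stcon ds = trans (qcount-within ds cs (eq (var zero) ct)) (+-identityʳ (length ds * 3))

module Semantics {m : ℕ} (G : Graph m) where
  open Reachability G

  EvalsTo : ∀ {k k′} → (Fin k′ → Fin m) → (Fin k → Term k′) → (Fin k → Fin m) → Set
  EvalsTo ρ σ ρ′ = ∀ i → evalTerm G ρ (σ i) ≡ ρ′ i

  eval-weaken : ∀ {k} (ρ : Fin k → Fin m) x a → evalTerm G (extend ρ x) (weaken a) ≡ evalTerm G ρ a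
  eval-weaken ρ x (var i) = refl
  eval-weaken ρ x cs      = refl
  eval-weaken ρ x ct      = refl

  eval-sub : ∀ {k k′} {σ : Fin k → Term k′} {ρ ρ′} → EvalsTo ρ σ ρ′ →
             ∀ a → evalTerm G ρ (subTerm σ a) ≡ evalTerm G ρ′ a
  eval-sub σ≈ (var i) = σ≈ i
  eval-sub σ≈ cs      = refl
  eval-sub σ≈ ct      = refl

  EvalsTo-lift : ∀ {k k′} {σ : Fin k → Term k′} {ρ ρ′} → EvalsTo ρ σ ρ′ →
                 ∀ x → EvalsTo (extend ρ x) (lift σ) (extend ρ′ x)
  EvalsTo-lift σ≈ x zero                   = refl
  EvalsTo-lift {σ = σ} {ρ} σ≈ x (suc i) = trans (eval-weaken ρ x (σ i)) (σ≈ i)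

  Sat-sub : ∀ {k k′} {σ : Fin k → Term k′} {ρ ρ′} → EvalsTo ρ σ ρ′ → ∀ φ → Sat G ρ (sub σ φ) ⇔ Sat G ρ′ φ
  Sat-sub σ≈ (edge a b) = mk⇔ (subst₂ (λ x y → E G x y ≡ true) (eval-sub σ≈ a) (eval-sub σ≈ b))
                                (subst₂ (λ x y → E G x y ≡ true) (sym (eval-sub σ≈ a)) (sym (eval-sub σ≈ b)))
  Sat-sub σ≈ (eq a b)   = mk⇔ (λ p → trans (sym (eval-sub σ≈ a)) (trans p (eval-sub σ≈ b)))
                                (λ p → trans (eval-sub σ≈ a) (trans p (sym (eval-sub σ≈ b))))
  Sat-sub σ≈ (neg φ)    = ¬-cong-⇔ (Sat-sub σ≈ φ)
  Sat-sub σ≈ (and φ ψ)  = Sat-sub σ≈ φ ×-⇔ Sat-sub σ≈ ψ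
  Sat-sub σ≈ (or φ ψ)   = Sat-sub σ≈ φ ⊎-⇔ Sat-sub σ≈ ψ
  Sat-sub σ≈ (all φ)    = ∀-cong-⇔ λ x → Sat-sub (EvalsTo-lift σ≈ x) φ
  Sat-sub σ≈ (ex φ)     = ∃-cong-⇔ λ x → Sat-sub (EvalsTo-lift σ≈ x) φ

  extend₃ : ∀ {k} → (Fin k → Fin m) → Fin m → Fin m → Fin m → Fin (3 + k) → Fin m
  extend₃ ρ a b u = extend (extend (extend ρ a) b) u

  Sat-reaches≤ : ∀ e {k} (ρ : Fin (suc k) → Fin m) a →
                 Sat G ρ (reaches≤ e a) ⇔ Reach (b2n e) (ρ zero) (_≡ evalTerm G ρ a)
  Sat-reaches≤ false ρ a = ⇔-sym Reach-zero
  Sat-reaches≤ true  ρ a = ⇔-sym Reach-one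

  Sat-legFormula : ∀ e₁ e₂ {k} (ρ : Fin k → Fin m) θ a b u w →
    Sat G (extend (extend₃ ρ a b u) w) (legFormula e₁ e₂ θ) ⇔ Leg e₁ e₂ a b (λ w → Sat G (extend ρ w) θ) u w
  Sat-legFormula e₁ e₂ ρ θ a b u w = mk⇔
    (λ where (inj₁ (u≡b , s))                → at-b u≡b (to θ≈ s)
             (inj₂ (inj₁ (u≢b , u≡a , r)))   → at-a u≢b u≡a (to (Sat-reaches≤ e₂ _ _) r)
             (inj₂ (inj₂ (u≢b , u≢a , r)))   → at-x u≢b u≢a (to (Sat-reaches≤ e₁ _ _) r))
    (λ where (at-b u≡b p)       → inj₁ (u≡b , from θ≈ p)
             (at-a u≢b u≡a r)   → inj₂ (inj₁ (u≢b , u≡a , from (Sat-reaches≤ e₂ _ _) r))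
             (at-x u≢b u≢a r)   → inj₂ (inj₂ (u≢b , u≢a , from (Sat-reaches≤ e₁ _ _) r)))
    where
    θ≈ : Sat G (extend (extend₃ ρ a b u) w) (sub (lift weaken₃) θ) ⇔ Sat G (extend ρ w) θ
    θ≈ = Sat-sub (λ { zero → refl ; (suc i) → refl }) θ

  Sat-onRoute : ∀ {k} (ρ : Fin k → Fin m) x a b u →
    Sat G (extend₃ ρ a b u) (onRoute x) ⇔ (u ≡ b ⊎ u ≡ a ⊎ u ≡ evalTerm G ρ x)
  Sat-onRoute ρ x a b u rewrite eval-sub {σ = weaken₃} {extend₃ ρ a b u} {ρ} (λ _ → refl) x = ⇔-id _

  Sat-within : ∀ ds {k} (ρ : Fin k → Fin m) u θ →
    Sat G ρ (within ds u θ) ⇔ Reach (val ds) (evalTerm G ρ u) (λ w → Sat G (extend ρ w) θ)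
  Sat-within [] ρ u θ = ⇔-sym Reach-zero ⇔-∘ Sat-sub (λ { zero → refl ; (suc i) → refl }) θ
  Sat-within ((e₁ , e₂) ∷ ds) ρ u θ =
    ⇔-sym Reach-valD⇔Legs ⇔-∘ (∃-cong-⇔ λ a → ∃-cong-⇔ λ b → ∀-cong-⇔ λ v →
      ¬⊎⇔→ (v ≟ b ⊎-dec v ≟ a ⊎-dec v ≟ evalTerm G ρ u)
      ⇔-∘ (¬-cong-⇔ (Sat-onRoute ρ u a b v)
           ⊎-⇔ Reach-cong (Sat-legFormula e₁ e₂ ρ θ a b v)
               ⇔-∘ Sat-within ds (extend₃ ρ a b v) (var zero) (legFormula e₁ e₂ θ)))

  Models-stcon : ∀ ds → Models G (stcon ds) ⇔ STCON (val ds) G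
  Models-stcon ds = Reach-≡⇔Walk ⇔-∘ Sat-within ds noVars cs (eq (var zero) ct)

theorem4p1 : Σ ℕ λ C → (n : ℕ) → 1 ≤ n →
    Σ Sentence λ φ → (3 ^ (qcount φ ∸ C) ≤ n ^ 3) ×
      ((m : ℕ) (G : Graph m) → Models G φ ⇔ STCON n G)
theorem4p1 = 3 , λ n 1≤n → let ds , val≡n , 3ᴸ≤3n = ternary n 1≤n in
  stcon ds ,
  subst (λ c → 3 ^ (c ∸ 3) ≤ n ^ 3) (sym (qcount-stcon ds)) (cube-bound (length ds) n 1≤n 3ᴸ≤3n) ,
  λ m G → subst (λ k → Models G (stcon ds) ⇔ STCON k G) val≡n (Semantics.Models-stcon G ds)
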